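{- Let $a\in\mathrm{Act}$ and let $\varphi$ be a closed formula in $\mathrm{eHML}\cap\mathrm{sHML}$ all of whose subformulae can refute. Then there is a formula $\psi\in\mathrm{eHML}\cap\mathrm{sHML}$ all of whose subformulae can refute, such that for every $f\in\mathrm{Act}^\infty$, $af\in[\![\varphi]\!]$ implies $f\in[\![\psi]\!]$. Dually, if $\varphi$ is a closed formula in $\mathrm{eHML}\cap\mathrm{cHML}$ all of whose subformulae can verify, then there is $\psi\in\mathrm{eHML}\cap\mathrm{cHML}$ all of whose subformulae can verify, such that for every $f\in\mathrm{Act}^\infty$, $f\in[\![\psi]\!]$ implies $af\in[\![\varphi]\!]$.
   Context: $\mathrm{Act}$ is a finite set of actions, $\mathrm{Act}^\infty=\mathrm{Act}^*\cup\mathrm{Act}^\omega$. Logic $\mu\mathrm{HML}$: $\varphi::=\mathsf{tt}\mid\mathsf{ff}\mid\varphi\lor\varphi\mid\varphi\land\varphi\mid\langle a\rangle\varphi\mid[a]\varphi\mid\min X.\varphi\mid\max X.\varphi\mid X$, interpreted over $\mathrm{Act}^\infty$: $[\![\mathsf{tt}]\!]=\mathrm{Act}^\infty$, $[\![\mathsf{ff}]\!]=\emptyset$, $\lor,\land$ union/intersection, $[\![[a]\varphi]\!]=\{f\mid f=af'\Rightarrow f'\in[\![\varphi]\!]\}$, $[\![\langle a\rangle\varphi]\!]=\{af\mid f\in[\![\varphi]\!]\}$, $\min X$/$\max X$ least/greatest fixpoints (using valuations). Formulae are closed and guarded. $\mathrm{sHML}$: $\varphi::=\mathsf{tt}\mid\mathsf{ff}\mid[a]\varphi\mid\varphi\land\varphi\mid\max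 X.\varphi\mid X$; $\mathrm{cHML}$: $\varphi::=\mathsf{tt}\mid\mathsf{ff}\mid\langle a\rangle\varphi\mid\varphi\lor\varphi\mid\min X.\varphi\mid X$; $\mathrm{eHML}$: $\varphi::=\mathsf{tt}\mid\mathsf{ff}\mid\min X.\varphi\mid\max X.\varphi\mid X\mid\varphi\lor\varphi\mid\varphi\land\varphi\mid\bigvee_{b\in\mathrm{Act}}\langle b\rangle\varphi_b\mid\bigwedge_{b\in\mathrm{Act}}[b]\varphi_b$. For a closed $\mathrm{sHML}$ (resp. $\mathrm{cHML}$) formula $\varphi$, a subformula $\psi$ can refute (resp. verify) in $0$ unfoldings if $\mathsf{ff}$ (resp. $\mathsf{tt}$) occurs in $\psi$; in $k+1$ unfoldings if it can in $k$, or $X$ occurs in $\psi$ and $\psi$ lies in the scope of a subformula $\max X.\psi'$ (resp. $\min X.\psi'$) that can refute (resp. verify) in $k$ unfoldings; it can refute (verify) if it can in some number $k\ge 0$ of unfoldings. -}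

module Defs where

open import Level using (Level; Lift; lift) renaming (suc to lsuc; zero to lzero)
open import Data.Nat using (ℕ; zero; suc)
open import Data.Fin using (Fin; zero; suc)
open import Data.List using (List; []; _∷_)
open import Data.Maybe using (Maybe; just; nothing)
open import Data.Product using (Σ; _×_; _,_; ∃)
open import Data.Sum using (_⊎_; inj₁; inj₂)
open import Data.Unit.Polymorphic using (⊤)
open import Data.Empty.Polymorphic using (⊥)
open import Relation.Nullary using (¬_)
open import Relation.Binary.PropositionalEquality using (_≡_)

-- Actions and traces.  Act = Fin n (an arbitrary finite set).
-- Act^∞ = Act^* ∪ Act^ω : finite traces are lists, infinite traces are
-- functions ℕ → Act.

Act : ℕ → Set
Act n = Fin n

Trace : ℕ → Set
Trace n = List (Act n) ⊎ (ℕ → Act n)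

_·_ : ∀ {n} → Act n → Trace n → Trace n
a · inj₁ l = inj₁ (a ∷ l)
a · inj₂ s = inj₂ λ { zero → a ; (suc i) → s i }

step : ∀ {n} → Trace n → Maybe (Act n × Trace n)
step (inj₁ [])      = nothing
step (inj₁ (b ∷ l)) = just (b , inj₁ l)
step (inj₂ s)       = just (s zero , inj₂ λ i → s (suc i))

-- Syntax: μHML extended with the eHML constructs
--   ⋁_{b∈Act} ⟨b⟩φ_b  (bigOr)   and   ⋀_{b∈Act} [b]φ_b  (bigAnd).
-- Variables are de Bruijn indices; Form n k has k free variables.

data Form (n : ℕ) : ℕ → Set where
  tt ff   : ∀ {k} → Form n k
  _∨_ _∧_ : ∀ {k} → Form n k → Form n k → Form n k
  ⟨_⟩_ [_]_ : ∀ {k} → Act n → Form n k → Form n k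
  min max : ∀ {k} → Form n (suc k) → Form n k
  var     : ∀ {k} → Fin k → Form n k
  bigOr bigAnd : ∀ {k} → (Act n → Form n k) → Form n k

-- Semantics over Act^∞ (sets of traces as predicates; fixpoints by
-- Knaster–Tarski: lfp = intersection of prefixed points, gfp = union of
-- postfixed points).

Val : ℕ → ℕ → Set₁
Val n k = Fin k → (Trace n → Set)

extend : ∀ {n k} → (Trace n → Set) → Val n k → Val n (suc k)
extend S ρ zero    = S
extend S ρ (suc i) = ρ i

⟦_⟧ : ∀ {n k} → Form n k → Val n k → Trace n → Set₁
⟦ tt ⟧ ρ f = ⊤
⟦ ff ⟧ ρ f = ⊥
⟦ φ ∨ ψ ⟧ ρ f = ⟦ φ ⟧ ρ f ⊎ ⟦ ψ ⟧ ρ f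
⟦ φ ∧ ψ ⟧ ρ f = ⟦ φ ⟧ ρ f × ⟦ ψ ⟧ ρ f
⟦ ⟨ a ⟩ φ ⟧ ρ f = Σ (Trace _) λ f′ → (step f ≡ just (a , f′)) × ⟦ φ ⟧ ρ f′
⟦ [ a ] φ ⟧ ρ f = ∀ f′ → step f ≡ just (a , f′) → ⟦ φ ⟧ ρ f′
⟦ min φ ⟧ ρ f = (S : Trace _ → Set) → (∀ g → ⟦ φ ⟧ (extend S ρ) g → S g) → S f
⟦ max φ ⟧ ρ f = Σ (Trace _ → Set) λ S → (∀ g → S g → ⟦ φ ⟧ (extend S ρ) g) × S f
⟦ var i ⟧ ρ f = Lift _ (ρ i f)
⟦ bigOr φs ⟧ ρ f = Σ (Act _) λ b → Σ (Trace _) λ f′ → (step f ≡ just (b , f′)) × ⟦ φs b ⟧ ρ f′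
⟦ bigAnd φs ⟧ ρ f = ∀ b f′ → step f ≡ just (b , f′) → ⟦ φs b ⟧ ρ f′

ρ₀ : ∀ {n} → Val n 0
ρ₀ ()

⟦_⟧₀ : ∀ {n} → Form n 0 → Trace n → Set₁
⟦ φ ⟧₀ = ⟦ φ ⟧ ρ₀

-- Fragments: eHML ∩ sHML and eHML ∩ cHML.

data SE {n} : ∀ {k} → Form n k → Set where
  tt  : ∀ {k} → SE {k = k} tt
  ff  : ∀ {k} → SE {k = k} ff
  var : ∀ {k} (i : Fin k) → SE (var i)
  _∧_ : ∀ {k} {φ ψ : Form n k} → SE φ → SE ψ → SE (φ ∧ ψ)
  max : ∀ {k} {φ : Form n (suc k)} → SE φ → SE (max φ)
  bigAnd : ∀ {k} {φs : Act n → Form n k} → (∀ b → SE (φs b)) → SE (bigAnd φs)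

data CE {n} : ∀ {k} → Form n k → Set where
  tt  : ∀ {k} → CE {k = k} tt
  ff  : ∀ {k} → CE {k = k} ff
  var : ∀ {k} (i : Fin k) → CE (var i)
  _∨_ : ∀ {k} {φ ψ : Form n k} → CE φ → CE ψ → CE (φ ∨ ψ)
  min : ∀ {k} {φ : Form n (suc k)} → CE φ → CE (min φ)
  bigOr : ∀ {k} {φs : Act n → Form n k} → (∀ b → CE (φs b)) → CE (bigOr φs)

-- Guardedness: every bound variable occurs under a modality in the body
-- of its binder.

data Unguarded {n} : ∀ {k} → Fin k → Form n k → Set where
  var  : ∀ {k} (i : Fin k) → Unguarded i (var i)
  ∨ˡ   : ∀ {k} {i : Fin k} {φ ψ} → Unguarded i φ → Unguarded i (φ ∨ ψ)
  ∨ʳ   : ∀ {k} {i : Fin k} {φ ψ} → Unguarded i ψ → Unguarded i (φ ∨ ψ)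
  ∧ˡ   : ∀ {k} {i : Fin k} {φ ψ} → Unguarded i φ → Unguarded i (φ ∧ ψ)
  ∧ʳ   : ∀ {k} {i : Fin k} {φ ψ} → Unguarded i ψ → Unguarded i (φ ∧ ψ)
  min  : ∀ {k} {i : Fin k} {φ} → Unguarded (suc i) φ → Unguarded i (min φ)
  max  : ∀ {k} {i : Fin k} {φ} → Unguarded (suc i) φ → Unguarded i (max φ)

data Guarded {n} : ∀ {k} → Form n k → Set where
  tt  : ∀ {k} → Guarded {k = k} tt
  ff  : ∀ {k} → Guarded {k = k} ff
  var : ∀ {k} (i : Fin k) → Guarded (var i)
  _∨_ : ∀ {k} {φ ψ : Form n k} → Guarded φ → Guarded ψ → Guarded (φ ∨ ψ)
  _∧_ : ∀ {k} {φ ψ : Form n k} → Guarded φ → Guarded ψ → Guarded (φ ∧ ψ)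
  dia : ∀ {k} (a : Act n) {φ : Form n k} → Guarded φ → Guarded (⟨ a ⟩ φ)
  box : ∀ {k} (a : Act n) {φ : Form n k} → Guarded φ → Guarded ([ a ] φ)
  min : ∀ {k} {φ : Form n (suc k)} → ¬ Unguarded zero φ → Guarded φ → Guarded (min φ)
  max : ∀ {k} {φ : Form n (suc k)} → ¬ Unguarded zero φ → Guarded φ → Guarded (max φ)
  bigOr  : ∀ {k} {φs : Act n → Form n k} → (∀ b → Guarded (φs b)) → Guarded (bigOr φs)
  bigAnd : ∀ {k} {φs : Act n → Form n k} → (∀ b → Guarded (φs b)) → Guarded (bigAnd φs)

data Occurs {n} : ∀ {k} → Fin k → Form n k → Set where
  var  : ∀ {k} (i : Fin k) → Occurs i (var i)
  ∨ˡ   : ∀ {k} {i : Fin k} {φ ψ} → Occurs i φ → Occurs i (φ ∨ ψ)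
  ∨ʳ   : ∀ {k} {i : Fin k} {φ ψ} → Occurs i ψ → Occurs i (φ ∨ ψ)
  ∧ˡ   : ∀ {k} {i : Fin k} {φ ψ} → Occurs i φ → Occurs i (φ ∧ ψ)
  ∧ʳ   : ∀ {k} {i : Fin k} {φ ψ} → Occurs i ψ → Occurs i (φ ∧ ψ)
  dia  : ∀ {k} {i : Fin k} {a φ} → Occurs i φ → Occurs i (⟨ a ⟩ φ)
  box  : ∀ {k} {i : Fin k} {a φ} → Occurs i φ → Occurs i ([ a ] φ)
  min  : ∀ {k} {i : Fin k} {φ} → Occurs (suc i) φ → Occurs i (min φ)
  max  : ∀ {k} {i : Fin k} {φ} → Occurs (suc i) φ → Occurs i (max φ)
  bigOr  : ∀ {k} {i : Fin k} {φs} (b : Act n) → Occurs i (φs b) → Occurs i (bigOr φs)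
  bigAnd : ∀ {k} {i : Fin k} {φs} (b : Act n) → Occurs i (φs b) → Occurs i (bigAnd φs)

data Kind : Set where
  μ ν : Kind

fix : ∀ {n k} → Kind → Form n (suc k) → Form n k
fix μ = min
fix ν = max

data ConstIn {n} : Kind → ∀ {k} → Form n k → Set where
  ff-here : ∀ {k} → ConstIn ν {k} ff
  tt-here : ∀ {k} → ConstIn μ {k} tt
  ∨ˡ   : ∀ {κ k} {φ ψ : Form n k} → ConstIn κ φ → ConstIn κ (φ ∨ ψ)
  ∨ʳ   : ∀ {κ k} {φ ψ : Form n k} → ConstIn κ ψ → ConstIn κ (φ ∨ ψ)
  ∧ˡ   : ∀ {κ k} {φ ψ : Form n k} → ConstIn κ φ → ConstIn κ (φ ∧ ψ)
  ∧ʳ   : ∀ {κ k} {φ ψ : Form n k} → ConstIn κ ψ → ConstIn κ (φ ∧ ψ)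
  dia  : ∀ {κ k} {a} {φ : Form n k} → ConstIn κ φ → ConstIn κ (⟨ a ⟩ φ)
  box  : ∀ {κ k} {a} {φ : Form n k} → ConstIn κ φ → ConstIn κ ([ a ] φ)
  min  : ∀ {κ k} {φ : Form n (suc k)} → ConstIn κ φ → ConstIn κ (min φ)
  max  : ∀ {κ k} {φ : Form n (suc k)} → ConstIn κ φ → ConstIn κ (max φ)
  bigOr  : ∀ {κ k} {φs : Act n → Form n k} (b : Act n) → ConstIn κ (φs b) → ConstIn κ (bigOr φs)
  bigAnd : ∀ {κ k} {φs : Act n → Form n k} (b : Act n) → ConstIn κ (φs b) → ConstIn κ (bigAnd φs)

-- Binder contexts: the chain of fixpoint binders σX.ψ' in whose scope a
-- subformula lies (innermost last).  Entry i (de Bruijn) records the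
-- binder's kind, its body, and the context of the binder itself.

data Ctx (n : ℕ) : ℕ → Set where
  ε     : Ctx n 0
  _▸_,_ : ∀ {k} → Ctx n k → Kind → Form n (suc k) → Ctx n (suc k)

-- Binds Γ i Δ κ ψ' : variable i of Γ is bound by the binder (fix κ ψ'),
-- which itself lies in context Δ.
data Binds {n} : ∀ {k} → Ctx n k → Fin k → ∀ {j} → Ctx n j → Kind → Form n (suc j) → Set where
  here  : ∀ {k} {Γ : Ctx n k} {κ φ} → Binds (Γ ▸ κ , φ) zero Γ κ φ
  there : ∀ {k} {Γ : Ctx n k} {κ φ} {i j} {Δ : Ctx n j} {κ′ ψ} →
          Binds Γ i Δ κ′ ψ → Binds (Γ ▸ κ , φ) (suc i) Δ κ′ ψ

-- "can refute (κ = ν) / can verify (κ = μ) in m unfoldings".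
-- Can κ Γ ψ m : the subformula ψ, lying in binder context Γ, can refute
-- (resp. verify) in m unfoldings.

data Can {n} (κ : Kind) : ∀ {k} → Ctx n k → Form n k → ℕ → Set where
  base  : ∀ {k} {Γ : Ctx n k} {ψ} → ConstIn κ ψ → Can κ Γ ψ zero
  later : ∀ {k} {Γ : Ctx n k} {ψ m} → Can κ Γ ψ m → Can κ Γ ψ (suc m)
  bound : ∀ {k} {Γ : Ctx n k} {ψ m} (i : Fin k) {j} {Δ : Ctx n j} {ψ′} →
          Occurs i ψ → Binds Γ i Δ κ ψ′ → Can κ Δ (fix κ ψ′) m →
          Can κ Γ ψ (suc m)

CanRefute : ∀ {n k} → Ctx n k → Form n k → Set
CanRefute Γ ψ = ∃ λ m → Can ν Γ ψ m

CanVerify : ∀ {n k} → Ctx n k → Form n k → Set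
CanVerify Γ ψ = ∃ λ m → Can μ Γ ψ m

Every : ∀ {n} → (∀ {k} → Ctx n k → Form n k → Set) → ∀ {k} → Ctx n k → Form n k → Set
Every P Γ tt = P Γ tt
Every P Γ ff = P Γ ff
Every P Γ (φ ∨ ψ) = P Γ (φ ∨ ψ) × Every P Γ φ × Every P Γ ψ
Every P Γ (φ ∧ ψ) = P Γ (φ ∧ ψ) × Every P Γ φ × Every P Γ ψ
Every P Γ (⟨ a ⟩ φ) = P Γ (⟨ a ⟩ φ) × Every P Γ φ
Every P Γ ([ a ] φ) = P Γ ([ a ] φ) × Every P Γ φ
Every P Γ (min φ) = P Γ (min φ) × Every P (Γ ▸ μ , φ) φ
Every P Γ (max φ) = P Γ (max φ) × Every P (Γ ▸ ν , φ) φ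
Every P Γ (var i) = P Γ (var i)
Every P Γ (bigOr φs) = P Γ (bigOr φs) × (∀ b → Every P Γ (φs b))
Every P Γ (bigAnd φs) = P Γ (bigAnd φs) × (∀ b → Every P Γ (φs b))

module Submission where

-- ψ is the derivative of φ along a.  Up to unfolding fixpoints, a guarded closed formula of
-- eHML ∩ sHML is a conjunction of ff, tt and formulae ⋀_b [b]φ_b; the derivative keeps ff,
-- replaces ⋀_b [b]φ_b by φ_a, and never meets tt because tt cannot refute (dually for cHML,
-- where ff cannot verify).  The recursion terminates because unfolding a guarded fixpoint does
-- not change the connectives above the modalities, and "every subformula can refute" survives
-- unfolding: a subformula that refuted through the bound variable now contains the fixpoint
-- itself, which refutes one unfolding earlier.

open import Defs
open import Data.Nat using (ℕ; zero; suc; _≤_; _+_; s≤s)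
open import Data.Nat.Properties using (m+n≤o⇒m≤o; m+n≤o⇒n≤o; ≤-refl)
open import Data.Fin using (Fin; zero; suc)
open import Data.Fin.Properties using (suc-injective)
open import Data.Product using (Σ; _×_; _,_; proj₁; proj₂; ∃)
open import Data.Sum using (_⊎_; inj₁; inj₂)
open import Data.Maybe using (just)
open import Data.Empty using (⊥-elim)
open import Level using (lift; lower)
open import Relation.Nullary using (¬_)
open import Relation.Unary using (_⊆_)
open import Relation.Binary.PropositionalEquality using (_≡_; refl; sym; cong; cong₂; subst)

module _ {n : ℕ} where

  ext : ∀ {k k′} → (Fin k → Fin k′) → Fin (suc k) → Fin (suc k′)
  ext r zero    = zero
  ext r (suc i) = suc (r i)

  rename : ∀ {k k′} → (Fin k → Fin k′) → Form n k → Form n k′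
  rename r tt          = tt
  rename r ff          = ff
  rename r (φ ∨ ψ)     = rename r φ ∨ rename r ψ
  rename r (φ ∧ ψ)     = rename r φ ∧ rename r ψ
  rename r (⟨ a ⟩ φ)   = ⟨ a ⟩ rename r φ
  rename r ([ a ] φ)   = [ a ] rename r φ
  rename r (min φ)     = min (rename (ext r) φ)
  rename r (max φ)     = max (rename (ext r) φ)
  rename r (var i)     = var (r i)
  rename r (bigOr φs)  = bigOr λ b → rename r (φs b)
  rename r (bigAnd φs) = bigAnd λ b → rename r (φs b)

  exts : ∀ {k k′} → (Fin k → Form n k′) → Fin (suc k) → Form n (suc k′)
  exts σ zero    = var zero
  exts σ (suc i) = rename suc (σ i)

  sub : ∀ {k k′} → (Fin k → Form n k′) → Form n k → Form n k′
  sub σ tt          = tt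
  sub σ ff          = ff
  sub σ (φ ∨ ψ)     = sub σ φ ∨ sub σ ψ
  sub σ (φ ∧ ψ)     = sub σ φ ∧ sub σ ψ
  sub σ (⟨ a ⟩ φ)   = ⟨ a ⟩ sub σ φ
  sub σ ([ a ] φ)   = [ a ] sub σ φ
  sub σ (min φ)     = min (sub (exts σ) φ)
  sub σ (max φ)     = max (sub (exts σ) φ)
  sub σ (var i)     = σ i
  sub σ (bigOr φs)  = bigOr λ b → sub σ (φs b)
  sub σ (bigAnd φs) = bigAnd λ b → sub σ (φs b)

  single : ∀ {k} → Form n k → Fin (suc k) → Form n k
  single χ zero    = χ
  single χ (suc i) = var i

  _[_] : ∀ {k} → Form n (suc k) → Form n k → Form n k
  β [ χ ] = sub (single χ) β

  rename-fix : ∀ {k k′} κ (r : Fin k → Fin k′) (β : Form n (suc k)) →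
               rename r (fix κ β) ≡ fix κ (rename (ext r) β)
  rename-fix μ r β = refl
  rename-fix ν r β = refl

  sub-fix : ∀ {k k′} κ (σ : Fin k → Form n k′) (β : Form n (suc k)) →
            sub σ (fix κ β) ≡ fix κ (sub (exts σ) β)
  sub-fix μ σ β = refl
  sub-fix ν σ β = refl

  ConstIn-rename : ∀ {κ k k′} (r : Fin k → Fin k′) {θ : Form n k} → ConstIn κ θ → ConstIn κ (rename r θ)
  ConstIn-rename r ff-here      = ff-here
  ConstIn-rename r tt-here      = tt-here
  ConstIn-rename r (∨ˡ c)       = ∨ˡ (ConstIn-rename r c)
  ConstIn-rename r (∨ʳ c)       = ∨ʳ (ConstIn-rename r c)
  ConstIn-rename r (∧ˡ c)       = ∧ˡ (ConstIn-rename r c)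
  ConstIn-rename r (∧ʳ c)       = ∧ʳ (ConstIn-rename r c)
  ConstIn-rename r (dia c)      = dia (ConstIn-rename r c)
  ConstIn-rename r (box c)      = box (ConstIn-rename r c)
  ConstIn-rename r (min c)      = min (ConstIn-rename (ext r) c)
  ConstIn-rename r (max c)      = max (ConstIn-rename (ext r) c)
  ConstIn-rename r (bigOr b c)  = bigOr b (ConstIn-rename r c)
  ConstIn-rename r (bigAnd b c) = bigAnd b (ConstIn-rename r c)

  ConstIn-sub : ∀ {κ k k′} (σ : Fin k → Form n k′) {θ : Form n k} → ConstIn κ θ → ConstIn κ (sub σ θ)
  ConstIn-sub σ ff-here      = ff-here
  ConstIn-sub σ tt-here      = tt-here
  ConstIn-sub σ (∨ˡ c)       = ∨ˡ (ConstIn-sub σ c)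
  ConstIn-sub σ (∨ʳ c)       = ∨ʳ (ConstIn-sub σ c)
  ConstIn-sub σ (∧ˡ c)       = ∧ˡ (ConstIn-sub σ c)
  ConstIn-sub σ (∧ʳ c)       = ∧ʳ (ConstIn-sub σ c)
  ConstIn-sub σ (dia c)      = dia (ConstIn-sub σ c)
  ConstIn-sub σ (box c)      = box (ConstIn-sub σ c)
  ConstIn-sub σ (min c)      = min (ConstIn-sub (exts σ) c)
  ConstIn-sub σ (max c)      = max (ConstIn-sub (exts σ) c)
  ConstIn-sub σ (bigOr b c)  = bigOr b (ConstIn-sub σ c)
  ConstIn-sub σ (bigAnd b c) = bigAnd b (ConstIn-sub σ c)

  Occurs-rename : ∀ {k k′} (r : Fin k → Fin k′) {i} {θ : Form n k} → Occurs i θ → Occurs (r i) (rename r θ)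
  Occurs-rename r (var i)      = var (r i)
  Occurs-rename r (∨ˡ o)       = ∨ˡ (Occurs-rename r o)
  Occurs-rename r (∨ʳ o)       = ∨ʳ (Occurs-rename r o)
  Occurs-rename r (∧ˡ o)       = ∧ˡ (Occurs-rename r o)
  Occurs-rename r (∧ʳ o)       = ∧ʳ (Occurs-rename r o)
  Occurs-rename r (dia o)      = dia (Occurs-rename r o)
  Occurs-rename r (box o)      = box (Occurs-rename r o)
  Occurs-rename r (min o)      = min (Occurs-rename (ext r) o)
  Occurs-rename r (max o)      = max (Occurs-rename (ext r) o)
  Occurs-rename r (bigOr b o)  = bigOr b (Occurs-rename r o)
  Occurs-rename r (bigAnd b o) = bigAnd b (Occurs-rename r o)

  record _≼_ {k} (χ θ : Form n k) : Set where
    constructor mk≼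
    field
      const  : ∀ {κ} → ConstIn κ χ → ConstIn κ θ
      occurs : ∀ {i} → Occurs i χ → Occurs i θ

  open _≼_

  ≼-trans : ∀ {k} {χ θ ξ : Form n k} → χ ≼ θ → θ ≼ ξ → χ ≼ ξ
  ≼-trans p q = mk≼ (λ c → const q (const p c)) (λ o → occurs q (occurs p o))

  sub-≼ : ∀ {k k′} (σ : Fin k → Form n k′) {x} {θ : Form n k} → Occurs x θ → σ x ≼ sub σ θ
  sub-≼ σ (var x)      = mk≼ (λ c → c) (λ o → o)
  sub-≼ σ (∨ˡ o)       = ≼-trans (sub-≼ σ o) (mk≼ ∨ˡ ∨ˡ)
  sub-≼ σ (∨ʳ o)       = ≼-trans (sub-≼ σ o) (mk≼ ∨ʳ ∨ʳ)
  sub-≼ σ (∧ˡ o)       = ≼-trans (sub-≼ σ o) (mk≼ ∧ˡ ∧ˡ)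
  sub-≼ σ (∧ʳ o)       = ≼-trans (sub-≼ σ o) (mk≼ ∧ʳ ∧ʳ)
  sub-≼ σ (dia o)      = ≼-trans (sub-≼ σ o) (mk≼ dia dia)
  sub-≼ σ (box o)      = ≼-trans (sub-≼ σ o) (mk≼ box box)
  sub-≼ σ (bigOr b o)  = ≼-trans (sub-≼ σ o) (mk≼ (bigOr b) (bigOr b))
  sub-≼ σ (bigAnd b o) = ≼-trans (sub-≼ σ o) (mk≼ (bigAnd b) (bigAnd b))
  sub-≼ σ (min o)      = let h = sub-≼ (exts σ) o in
    mk≼ (λ c → min (const h (ConstIn-rename suc c))) (λ p → min (occurs h (Occurs-rename suc p)))
  sub-≼ σ (max o)      = let h = sub-≼ (exts σ) o in
    mk≼ (λ c → max (const h (ConstIn-rename suc c))) (λ p → max (occurs h (Occurs-rename suc p)))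

  Can-mono : ∀ {κ k} {Γ : Ctx n k} {χ θ m} → χ ≼ θ → Can κ Γ χ m → Can κ Γ θ m
  Can-mono p (base c)        = base (const p c)
  Can-mono p (later c)       = later (Can-mono p c)
  Can-mono p (bound i o b c) = bound i (occurs p o) b c

  SE-rename : ∀ {k k′} (r : Fin k → Fin k′) {θ : Form n k} → SE θ → SE (rename r θ)
  SE-rename r tt          = tt
  SE-rename r ff          = ff
  SE-rename r (var i)     = var (r i)
  SE-rename r (s ∧ t)     = SE-rename r s ∧ SE-rename r t
  SE-rename r (max s)     = max (SE-rename (ext r) s)
  SE-rename r (bigAnd ss) = bigAnd λ b → SE-rename r (ss b)

  SE-sub : ∀ {k k′} (σ : Fin k → Form n k′) → (∀ x → SE (σ x)) → {θ : Form n k} → SE θ → SE (sub σ θ)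
  SE-sub σ sσ tt          = tt
  SE-sub σ sσ ff          = ff
  SE-sub σ sσ (var i)     = sσ i
  SE-sub σ sσ (s ∧ t)     = SE-sub σ sσ s ∧ SE-sub σ sσ t
  SE-sub σ sσ (max s)     = max (SE-sub (exts σ) SE-exts s)
    where SE-exts : ∀ x → SE (exts σ x)
          SE-exts zero    = var zero
          SE-exts (suc x) = SE-rename suc (sσ x)
  SE-sub σ sσ (bigAnd ss) = bigAnd λ b → SE-sub σ sσ (ss b)

  CE-rename : ∀ {k k′} (r : Fin k → Fin k′) {θ : Form n k} → CE θ → CE (rename r θ)
  CE-rename r tt         = tt
  CE-rename r ff         = ff
  CE-rename r (var i)    = var (r i)
  CE-rename r (s ∨ t)    = CE-rename r s ∨ CE-rename r t
  CE-rename r (min s)    = min (CE-rename (ext r) s)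
  CE-rename r (bigOr ss) = bigOr λ b → CE-rename r (ss b)

  CE-sub : ∀ {k k′} (σ : Fin k → Form n k′) → (∀ x → CE (σ x)) → {θ : Form n k} → CE θ → CE (sub σ θ)
  CE-sub σ sσ tt         = tt
  CE-sub σ sσ ff         = ff
  CE-sub σ sσ (var i)    = sσ i
  CE-sub σ sσ (s ∨ t)    = CE-sub σ sσ s ∨ CE-sub σ sσ t
  CE-sub σ sσ (min s)    = min (CE-sub (exts σ) CE-exts s)
    where CE-exts : ∀ x → CE (exts σ x)
          CE-exts zero    = var zero
          CE-exts (suc x) = CE-rename suc (sσ x)
  CE-sub σ sσ (bigOr ss) = bigOr λ b → CE-sub σ sσ (ss b)

  rename-Unguarded⁻ : ∀ {k k′} (r : Fin k → Fin k′) (θ : Form n k) {j} → Unguarded j (rename r θ) →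
                      Σ (Fin k) λ i → r i ≡ j × Unguarded i θ
  rename-Unguarded⁻ r (var i) (var _) = i , refl , var i
  rename-Unguarded⁻ r (φ ∨ ψ) (∨ˡ u) with rename-Unguarded⁻ r φ u
  ... | i , e , u′ = i , e , ∨ˡ u′
  rename-Unguarded⁻ r (φ ∨ ψ) (∨ʳ u) with rename-Unguarded⁻ r ψ u
  ... | i , e , u′ = i , e , ∨ʳ u′
  rename-Unguarded⁻ r (φ ∧ ψ) (∧ˡ u) with rename-Unguarded⁻ r φ u
  ... | i , e , u′ = i , e , ∧ˡ u′
  rename-Unguarded⁻ r (φ ∧ ψ) (∧ʳ u) with rename-Unguarded⁻ r ψ u
  ... | i , e , u′ = i , e , ∧ʳ u′
  rename-Unguarded⁻ r (min φ) (min u) with rename-Unguarded⁻ (ext r) φ u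
  ... | suc i , e , u′ = i , suc-injective e , min u′
  rename-Unguarded⁻ r (max φ) (max u) with rename-Unguarded⁻ (ext r) φ u
  ... | suc i , e , u′ = i , suc-injective e , max u′

  sub-Unguarded⁻ : ∀ {k k′} (σ : Fin k → Form n k′) (θ : Form n k) {j} → Unguarded j (sub σ θ) →
                   Σ (Fin k) λ x → Unguarded x θ × Unguarded j (σ x)
  sub-Unguarded⁻ σ (var x) u = x , var x , u
  sub-Unguarded⁻ σ (φ ∨ ψ) (∨ˡ u) with sub-Unguarded⁻ σ φ u
  ... | x , u′ , v = x , ∨ˡ u′ , v
  sub-Unguarded⁻ σ (φ ∨ ψ) (∨ʳ u) with sub-Unguarded⁻ σ ψ u
  ... | x , u′ , v = x , ∨ʳ u′ , v
  sub-Unguarded⁻ σ (φ ∧ ψ) (∧ˡ u) with sub-Unguarded⁻ σ φ u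
  ... | x , u′ , v = x , ∧ˡ u′ , v
  sub-Unguarded⁻ σ (φ ∧ ψ) (∧ʳ u) with sub-Unguarded⁻ σ ψ u
  ... | x , u′ , v = x , ∧ʳ u′ , v
  sub-Unguarded⁻ σ (min φ) (min u) with sub-Unguarded⁻ (exts σ) φ u
  ... | suc x , u′ , v with rename-Unguarded⁻ suc (σ x) v
  ... | _ , refl , w = x , min u′ , w
  sub-Unguarded⁻ σ (max φ) (max u) with sub-Unguarded⁻ (exts σ) φ u
  ... | suc x , u′ , v with rename-Unguarded⁻ suc (σ x) v
  ... | _ , refl , w = x , max u′ , w

  rename-guards-zero : ∀ {k k′} (r : Fin k → Fin k′) {φ : Form n (suc k)} →
                       ¬ Unguarded zero φ → ¬ Unguarded zero (rename (ext r) φ)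
  rename-guards-zero r {φ} g u with rename-Unguarded⁻ (ext r) φ u
  ... | zero , _ , u′ = g u′

  sub-guards-zero : ∀ {k k′} (σ : Fin k → Form n k′) {φ : Form n (suc k)} →
                    ¬ Unguarded zero φ → ¬ Unguarded zero (sub (exts σ) φ)
  sub-guards-zero σ {φ} g u with sub-Unguarded⁻ (exts σ) φ u
  ... | zero , u′ , _ = g u′
  ... | suc x , _ , v with rename-Unguarded⁻ suc (σ x) v
  ... | _ , () , _

  Guarded-rename : ∀ {k k′} (r : Fin k → Fin k′) {θ : Form n k} → Guarded θ → Guarded (rename r θ)
  Guarded-rename r tt          = tt
  Guarded-rename r ff          = ff
  Guarded-rename r (var i)     = var (r i)
  Guarded-rename r (g ∨ h)     = Guarded-rename r g ∨ Guarded-rename r h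
  Guarded-rename r (g ∧ h)     = Guarded-rename r g ∧ Guarded-rename r h
  Guarded-rename r (dia a g)   = dia a (Guarded-rename r g)
  Guarded-rename r (box a g)   = box a (Guarded-rename r g)
  Guarded-rename r (min u g)   = min (rename-guards-zero r u) (Guarded-rename (ext r) g)
  Guarded-rename r (max u g)   = max (rename-guards-zero r u) (Guarded-rename (ext r) g)
  Guarded-rename r (bigOr gs)  = bigOr λ b → Guarded-rename r (gs b)
  Guarded-rename r (bigAnd gs) = bigAnd λ b → Guarded-rename r (gs b)

  Guarded-exts : ∀ {k k′} (σ : Fin k → Form n k′) → (∀ x → Guarded (σ x)) → ∀ x → Guarded (exts σ x)
  Guarded-exts σ gσ zero    = var zero
  Guarded-exts σ gσ (suc x) = Guarded-rename suc (gσ x)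

  Guarded-sub : ∀ {k k′} (σ : Fin k → Form n k′) → (∀ x → Guarded (σ x)) →
                {θ : Form n k} → Guarded θ → Guarded (sub σ θ)
  Guarded-sub σ gσ tt          = tt
  Guarded-sub σ gσ ff          = ff
  Guarded-sub σ gσ (var i)     = gσ i
  Guarded-sub σ gσ (g ∨ h)     = Guarded-sub σ gσ g ∨ Guarded-sub σ gσ h
  Guarded-sub σ gσ (g ∧ h)     = Guarded-sub σ gσ g ∧ Guarded-sub σ gσ h
  Guarded-sub σ gσ (dia a g)   = dia a (Guarded-sub σ gσ g)
  Guarded-sub σ gσ (box a g)   = box a (Guarded-sub σ gσ g)
  Guarded-sub σ gσ (min u g)   = min (sub-guards-zero σ u) (Guarded-sub (exts σ) (Guarded-exts σ gσ) g)
  Guarded-sub σ gσ (max u g)   = max (sub-guards-zero σ u) (Guarded-sub (exts σ) (Guarded-exts σ gσ) g)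
  Guarded-sub σ gσ (bigOr gs)  = bigOr λ b → Guarded-sub σ gσ (gs b)
  Guarded-sub σ gσ (bigAnd gs) = bigAnd λ b → Guarded-sub σ gσ (gs b)

  -- Counts only the connectives above the modalities, so unfolding a guarded fixpoint preserves it.
  size : ∀ {k} → Form n k → ℕ
  size (φ ∨ ψ) = suc (size φ + size ψ)
  size (φ ∧ ψ) = suc (size φ + size ψ)
  size (min φ) = suc (size φ)
  size (max φ) = suc (size φ)
  size _       = 1

  exts-var-on-Unguarded : ∀ {k k′} (σ : Fin k → Form n k′) {φ : Form n (suc k)} →
             (∀ x → Unguarded (suc x) φ → ∃ λ y → σ x ≡ var y) →
             ∀ x → Unguarded x φ → ∃ λ y → exts σ x ≡ var y
  exts-var-on-Unguarded σ h zero    u = zero , refl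
  exts-var-on-Unguarded σ h (suc x) u with h x u
  ... | y , e = suc y , cong (rename suc) e

  size-sub : ∀ {k k′} (σ : Fin k → Form n k′) (θ : Form n k) →
             (∀ x → Unguarded x θ → ∃ λ y → σ x ≡ var y) → size (sub σ θ) ≡ size θ
  size-sub σ tt          h = refl
  size-sub σ ff          h = refl
  size-sub σ (⟨ a ⟩ θ)   h = refl
  size-sub σ ([ a ] θ)   h = refl
  size-sub σ (bigOr φs)  h = refl
  size-sub σ (bigAnd φs) h = refl
  size-sub σ (var x)     h = cong size (proj₂ (h x (var x)))
  size-sub σ (φ ∨ ψ)     h = cong₂ (λ p q → suc (p + q))
    (size-sub σ φ λ x u → h x (∨ˡ u)) (size-sub σ ψ λ x u → h x (∨ʳ u))
  size-sub σ (φ ∧ ψ)     h = cong₂ (λ p q → suc (p + q))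
    (size-sub σ φ λ x u → h x (∧ˡ u)) (size-sub σ ψ λ x u → h x (∧ʳ u))
  size-sub σ (min φ)     h = cong suc (size-sub (exts σ) φ (exts-var-on-Unguarded σ λ x u → h x (min u)))
  size-sub σ (max φ)     h = cong suc (size-sub (exts σ) φ (exts-var-on-Unguarded σ λ x u → h x (max u)))


  extend-⊆ : ∀ {k k′} {r : Fin k → Fin k′} {ρ : Val n k} {ρ′ : Val n k′} (S : Trace n → Set) →
             (∀ x → ρ x ⊆ ρ′ (r x)) → ∀ x → extend S ρ x ⊆ extend S ρ′ (ext r x)
  extend-⊆ S h zero    p = p
  extend-⊆ S h (suc x) p = h x p

  extend-⊇ : ∀ {k k′} {r : Fin k → Fin k′} {ρ : Val n k} {ρ′ : Val n k′} (S : Trace n → Set) →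
             (∀ x → ρ′ (r x) ⊆ ρ x) → ∀ x → extend S ρ′ (ext r x) ⊆ extend S ρ x
  extend-⊇ S h zero    p = p
  extend-⊇ S h (suc x) p = h x p

  ⟦⟧-rename⁺ : ∀ {k k′} (r : Fin k → Fin k′) (θ : Form n k) {ρ : Val n k} {ρ′ : Val n k′} →
               (∀ x → ρ x ⊆ ρ′ (r x)) → ⟦ θ ⟧ ρ ⊆ ⟦ rename r θ ⟧ ρ′
  ⟦⟧-rename⁺ r tt          h t                  = t
  ⟦⟧-rename⁺ r (φ ∨ ψ)     h (inj₁ t)           = inj₁ (⟦⟧-rename⁺ r φ h t)
  ⟦⟧-rename⁺ r (φ ∨ ψ)     h (inj₂ t)           = inj₂ (⟦⟧-rename⁺ r ψ h t)
  ⟦⟧-rename⁺ r (φ ∧ ψ)     h (t , u)            = ⟦⟧-rename⁺ r φ h t , ⟦⟧-rename⁺ r ψ h u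
  ⟦⟧-rename⁺ r (⟨ a ⟩ φ)   h (f′ , e , t)       = f′ , e , ⟦⟧-rename⁺ r φ h t
  ⟦⟧-rename⁺ r ([ a ] φ)   h H                  = λ f′ e → ⟦⟧-rename⁺ r φ h (H f′ e)
  ⟦⟧-rename⁺ r (min φ)     h H                  = λ S pre →
    H S λ g t → pre g (⟦⟧-rename⁺ (ext r) φ (extend-⊆ S h) t)
  ⟦⟧-rename⁺ r (max φ)     h (S , post , s)     =
    S , (λ g t → ⟦⟧-rename⁺ (ext r) φ (extend-⊆ S h) (post g t)) , s
  ⟦⟧-rename⁺ r (var i)     h (lift p)           = lift (h i p)
  ⟦⟧-rename⁺ r (bigOr φs)  h (b , f′ , e , t)   = b , f′ , e , ⟦⟧-rename⁺ r (φs b) h t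
  ⟦⟧-rename⁺ r (bigAnd φs) h H                  = λ b f′ e → ⟦⟧-rename⁺ r (φs b) h (H b f′ e)

  ⟦⟧-rename⁻ : ∀ {k k′} (r : Fin k → Fin k′) (θ : Form n k) {ρ : Val n k} {ρ′ : Val n k′} →
               (∀ x → ρ′ (r x) ⊆ ρ x) → ⟦ rename r θ ⟧ ρ′ ⊆ ⟦ θ ⟧ ρ
  ⟦⟧-rename⁻ r tt          h t                  = t
  ⟦⟧-rename⁻ r (φ ∨ ψ)     h (inj₁ t)           = inj₁ (⟦⟧-rename⁻ r φ h t)
  ⟦⟧-rename⁻ r (φ ∨ ψ)     h (inj₂ t)           = inj₂ (⟦⟧-rename⁻ r ψ h t)
  ⟦⟧-rename⁻ r (φ ∧ ψ)     h (t , u)            = ⟦⟧-rename⁻ r φ h t , ⟦⟧-rename⁻ r ψ h u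
  ⟦⟧-rename⁻ r (⟨ a ⟩ φ)   h (f′ , e , t)       = f′ , e , ⟦⟧-rename⁻ r φ h t
  ⟦⟧-rename⁻ r ([ a ] φ)   h H                  = λ f′ e → ⟦⟧-rename⁻ r φ h (H f′ e)
  ⟦⟧-rename⁻ r (min φ)     h H                  = λ S pre →
    H S λ g t → pre g (⟦⟧-rename⁻ (ext r) φ (extend-⊇ S h) t)
  ⟦⟧-rename⁻ r (max φ)     h (S , post , s)     =
    S , (λ g t → ⟦⟧-rename⁻ (ext r) φ (extend-⊇ S h) (post g t)) , s
  ⟦⟧-rename⁻ r (var i)     h (lift p)           = lift (h i p)
  ⟦⟧-rename⁻ r (bigOr φs)  h (b , f′ , e , t)   = b , f′ , e , ⟦⟧-rename⁻ r (φs b) h t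
  ⟦⟧-rename⁻ r (bigAnd φs) h H                  = λ b f′ e → ⟦⟧-rename⁻ r (φs b) h (H b f′ e)

  extend-⊆-exts : ∀ {k k′} {σ : Fin k → Form n k′} {ρ : Val n k} {ρ′ : Val n k′} (S : Trace n → Set) →
                  (∀ x → ρ x ⊆ ⟦ σ x ⟧ ρ′) → ∀ x → extend S ρ x ⊆ ⟦ exts σ x ⟧ (extend S ρ′)
  extend-⊆-exts         S h zero    p = lift p
  extend-⊆-exts {σ = σ} S h (suc x) p = ⟦⟧-rename⁺ suc (σ x) (λ _ q → q) (h x p)

  extend-⊇-exts : ∀ {k k′} {σ : Fin k → Form n k′} {ρ : Val n k} {ρ′ : Val n k′} (S : Trace n → Set) →
                  (∀ x → ⟦ σ x ⟧ ρ′ ⊆ ρ x) → ∀ x → ⟦ exts σ x ⟧ (extend S ρ′) ⊆ extend S ρ x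
  extend-⊇-exts         S h zero    p = lower p
  extend-⊇-exts {σ = σ} S h (suc x) p = h x (⟦⟧-rename⁻ suc (σ x) (λ _ q → q) p)

  ⟦⟧-sub⁺ : ∀ {k k′} (σ : Fin k → Form n k′) (θ : Form n k) {ρ : Val n k} {ρ′ : Val n k′} →
            (∀ x → ρ x ⊆ ⟦ σ x ⟧ ρ′) → ⟦ θ ⟧ ρ ⊆ ⟦ sub σ θ ⟧ ρ′
  ⟦⟧-sub⁺ σ tt          h t                = t
  ⟦⟧-sub⁺ σ (φ ∨ ψ)     h (inj₁ t)         = inj₁ (⟦⟧-sub⁺ σ φ h t)
  ⟦⟧-sub⁺ σ (φ ∨ ψ)     h (inj₂ t)         = inj₂ (⟦⟧-sub⁺ σ ψ h t)
  ⟦⟧-sub⁺ σ (φ ∧ ψ)     h (t , u)          = ⟦⟧-sub⁺ σ φ h t , ⟦⟧-sub⁺ σ ψ h u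
  ⟦⟧-sub⁺ σ (⟨ a ⟩ φ)   h (f′ , e , t)     = f′ , e , ⟦⟧-sub⁺ σ φ h t
  ⟦⟧-sub⁺ σ ([ a ] φ)   h H                = λ f′ e → ⟦⟧-sub⁺ σ φ h (H f′ e)
  ⟦⟧-sub⁺ σ (min φ)     h H                = λ S pre →
    H S λ g t → pre g (⟦⟧-sub⁺ (exts σ) φ (extend-⊆-exts S h) t)
  ⟦⟧-sub⁺ σ (max φ)     h (S , post , s)   =
    S , (λ g t → ⟦⟧-sub⁺ (exts σ) φ (extend-⊆-exts S h) (post g t)) , s
  ⟦⟧-sub⁺ σ (var i)     h (lift p)         = h i p
  ⟦⟧-sub⁺ σ (bigOr φs)  h (b , f′ , e , t) = b , f′ , e , ⟦⟧-sub⁺ σ (φs b) h t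
  ⟦⟧-sub⁺ σ (bigAnd φs) h H                = λ b f′ e → ⟦⟧-sub⁺ σ (φs b) h (H b f′ e)

  ⟦⟧-sub⁻ : ∀ {k k′} (σ : Fin k → Form n k′) (θ : Form n k) {ρ : Val n k} {ρ′ : Val n k′} →
            (∀ x → ⟦ σ x ⟧ ρ′ ⊆ ρ x) → ⟦ sub σ θ ⟧ ρ′ ⊆ ⟦ θ ⟧ ρ
  ⟦⟧-sub⁻ σ tt          h t                = t
  ⟦⟧-sub⁻ σ (φ ∨ ψ)     h (inj₁ t)         = inj₁ (⟦⟧-sub⁻ σ φ h t)
  ⟦⟧-sub⁻ σ (φ ∨ ψ)     h (inj₂ t)         = inj₂ (⟦⟧-sub⁻ σ ψ h t)
  ⟦⟧-sub⁻ σ (φ ∧ ψ)     h (t , u)          = ⟦⟧-sub⁻ σ φ h t , ⟦⟧-sub⁻ σ ψ h u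
  ⟦⟧-sub⁻ σ (⟨ a ⟩ φ)   h (f′ , e , t)     = f′ , e , ⟦⟧-sub⁻ σ φ h t
  ⟦⟧-sub⁻ σ ([ a ] φ)   h H                = λ f′ e → ⟦⟧-sub⁻ σ φ h (H f′ e)
  ⟦⟧-sub⁻ σ (min φ)     h H                = λ S pre →
    H S λ g t → pre g (⟦⟧-sub⁻ (exts σ) φ (extend-⊇-exts S h) t)
  ⟦⟧-sub⁻ σ (max φ)     h (S , post , s)   =
    S , (λ g t → ⟦⟧-sub⁻ (exts σ) φ (extend-⊇-exts S h) (post g t)) , s
  ⟦⟧-sub⁻ σ (var i)     h p                = lift (h i p)
  ⟦⟧-sub⁻ σ (bigOr φs)  h (b , f′ , e , t) = b , f′ , e , ⟦⟧-sub⁻ σ (φs b) h t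
  ⟦⟧-sub⁻ σ (bigAnd φs) h H                = λ b f′ e → ⟦⟧-sub⁻ σ (φs b) h (H b f′ e)

  unfold-max : (β : Form n 1) → ⟦ max β ⟧₀ ⊆ ⟦ β [ max β ] ⟧₀
  unfold-max β (S , post , s) = ⟦⟧-sub⁺ (single (max β)) β back-to-max (post _ s)
    where back-to-max : ∀ x → extend S ρ₀ x ⊆ ⟦ single (max β) x ⟧₀
          back-to-max zero p = S , post , p

  fold-min : (β : Form n 1) → ⟦ β [ min β ] ⟧₀ ⊆ ⟦ min β ⟧₀
  fold-min β t S pre = pre _ (⟦⟧-sub⁻ (single (min β)) β into-S t)
    where into-S : ∀ x → ⟦ single (min β) x ⟧₀ ⊆ extend S ρ₀ x
          into-S zero p = p S pre

  Can∃ : Kind → ∀ {k} → Ctx n k → Form n k → Set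
  Can∃ κ Γ χ = ∃ (Can κ Γ χ)

  Every-here : ∀ {P : ∀ {k} → Ctx n k → Form n k → Set} {k} {Γ : Ctx n k} (χ : Form n k) →
               Every P Γ χ → P Γ χ
  Every-here tt          e = e
  Every-here ff          e = e
  Every-here (φ ∨ ψ)     e = proj₁ e
  Every-here (φ ∧ ψ)     e = proj₁ e
  Every-here (⟨ a ⟩ φ)   e = proj₁ e
  Every-here ([ a ] φ)   e = proj₁ e
  Every-here (min φ)     e = proj₁ e
  Every-here (max φ)     e = proj₁ e
  Every-here (var i)     e = e
  Every-here (bigOr φs)  e = proj₁ e
  Every-here (bigAnd φs) e = proj₁ e

  -- Δ′ is Δ with one binder inserted; r is the induced renaming of variables.
  data Weakening : ∀ {k k′} → Ctx n k → Ctx n k′ → (Fin k → Fin k′) → Set where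
    insert : ∀ {k} {Γ : Ctx n k} {κ θ} → Weakening Γ (Γ ▸ κ , θ) suc
    under  : ∀ {k k′} {Δ : Ctx n k} {Δ′ : Ctx n k′} {r κ θ} → Weakening Δ Δ′ r →
             Weakening (Δ ▸ κ , θ) (Δ′ ▸ κ , rename (ext r) θ) (ext r)

  data WeakenedBinder {k k′} (Δ′ : Ctx n k′) (r : Fin k → Fin k′) (i : Fin k) :
                      ∀ {l} → Ctx n l → Kind → Form n (suc l) → Set where
    outside : ∀ {l} {Δ₀ : Ctx n l} {κ β} → Binds Δ′ (r i) Δ₀ κ β → WeakenedBinder Δ′ r i Δ₀ κ β
    inside  : ∀ {l l′} {Δ₀ : Ctx n l} {Δ₀′ : Ctx n l′} {r₀ κ β} → Weakening Δ₀ Δ₀′ r₀ →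
              Binds Δ′ (r i) Δ₀′ κ (rename (ext r₀) β) → WeakenedBinder Δ′ r i Δ₀ κ β

  Binds-weaken : ∀ {k k′} {Δ : Ctx n k} {Δ′ : Ctx n k′} {r i l} {Δ₀ : Ctx n l} {κ β} →
                 Weakening Δ Δ′ r → Binds Δ i Δ₀ κ β → WeakenedBinder Δ′ r i Δ₀ κ β
  Binds-weaken insert    b         = outside (there b)
  Binds-weaken (under w) here      = inside w here
  Binds-weaken (under w) (there b) with Binds-weaken w b
  ... | outside b′   = outside (there b′)
  ... | inside w₀ b′ = inside w₀ (there b′)

  Can-weaken : ∀ {κ k k′} {Δ : Ctx n k} {Δ′ : Ctx n k′} {r} {χ : Form n k} {m} →
               Weakening Δ Δ′ r → Can κ Δ χ m → Can κ Δ′ (rename r χ) m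
  Can-weaken {r = r} w (base c)  = base (ConstIn-rename r c)
  Can-weaken         w (later c) = later (Can-weaken w c)
  Can-weaken {κ} {r = r} w (bound i o b c) with Binds-weaken w b
  ... | outside b′ = bound (r i) (Occurs-rename r o) b′ c
  ... | inside {Δ₀′ = Δ₀′} {β = β} w₀ b′ =
    bound (r i) (Occurs-rename r o) b′ (subst (λ χ → Can κ Δ₀′ χ _) (rename-fix κ _ β) (Can-weaken w₀ c))

  Every-weaken : ∀ {κ k k′} {Δ : Ctx n k} {Δ′ : Ctx n k′} {r} → Weakening Δ Δ′ r →
                 (χ : Form n k) → Every (Can∃ κ) Δ χ → Every (Can∃ κ) Δ′ (rename r χ)
  Every-weaken w tt          (m , c)           = m , Can-weaken w c
  Every-weaken w ff          (m , c)           = m , Can-weaken w c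
  Every-weaken w (var i)     (m , c)           = m , Can-weaken w c
  Every-weaken w (φ ∨ ψ)     ((m , c) , e , e′) = (m , Can-weaken w c) , Every-weaken w φ e , Every-weaken w ψ e′
  Every-weaken w (φ ∧ ψ)     ((m , c) , e , e′) = (m , Can-weaken w c) , Every-weaken w φ e , Every-weaken w ψ e′
  Every-weaken w (⟨ a ⟩ φ)   ((m , c) , e)     = (m , Can-weaken w c) , Every-weaken w φ e
  Every-weaken w ([ a ] φ)   ((m , c) , e)     = (m , Can-weaken w c) , Every-weaken w φ e
  Every-weaken w (min φ)     ((m , c) , e)     = (m , Can-weaken w c) , Every-weaken (under w) φ e
  Every-weaken w (max φ)     ((m , c) , e)     = (m , Can-weaken w c) , Every-weaken (under w) φ e
  Every-weaken w (bigOr φs)  ((m , c) , e)     = (m , Can-weaken w c) , λ b → Every-weaken w (φs b) (e b)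
  Every-weaken w (bigAnd φs) ((m , c) , e)     = (m , Can-weaken w c) , λ b → Every-weaken w (φs b) (e b)

  -- Γ′ is the context left after replacing the outermost binder of Γ by the closed fixpoint
  -- it binds; σ is the induced substitution.
  data Unfolding (κ₀ : Kind) : ∀ {k} → Ctx n (suc k) → Ctx n k → (Fin (suc k) → Form n k) → Set where
    top   : ∀ {κ β} → Every (Can∃ κ₀) ε (fix κ β) → Unfolding κ₀ (ε ▸ κ , β) ε (single (fix κ β))
    under : ∀ {k} {Γ : Ctx n (suc k)} {Γ′ σ κ θ} → Unfolding κ₀ Γ Γ′ σ →
            Unfolding κ₀ (Γ ▸ κ , θ) (Γ′ ▸ κ , sub (exts σ) θ) (exts σ)

  data UnfoldedBinder (κ₀ : Kind) {k} (Γ′ : Ctx n k) (σ : Fin (suc k) → Form n k) (x : Fin (suc k)) :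
                      ∀ {l} → Ctx n l → Kind → Form n (suc l) → Set where
    unfolded : ∀ {κ β} → (∀ {m} → Can κ ε (fix κ β) m → Can κ Γ′ (σ x) m) → UnfoldedBinder κ₀ Γ′ σ x ε κ β
    inside   : ∀ {l} {Δ₀ : Ctx n (suc l)} {Δ₀′ σ₀ κ β} y → σ x ≡ var y → Unfolding κ₀ Δ₀ Δ₀′ σ₀ →
               Binds Γ′ y Δ₀′ κ (sub (exts σ₀) β) → UnfoldedBinder κ₀ Γ′ σ x Δ₀ κ β

  Binds-unfold : ∀ {κ₀ k} {Γ : Ctx n (suc k)} {Γ′ σ x l} {Δ₀ : Ctx n l} {κ β} →
                 Unfolding κ₀ Γ Γ′ σ → Binds Γ x Δ₀ κ β → UnfoldedBinder κ₀ Γ′ σ x Δ₀ κ β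
  Binds-unfold (top e)   here      = unfolded λ c → c
  Binds-unfold (under u) here      = inside zero refl u here
  Binds-unfold (under u) (there b) with Binds-unfold u b
  ... | unfolded f       = unfolded λ c → Can-weaken insert (f c)
  ... | inside y e u₀ b′ = inside (suc y) (cong (rename suc) e) u₀ (there b′)

  Can-unfold : ∀ {κ₀ κ k} {Γ : Ctx n (suc k)} {Γ′ σ} {χ : Form n (suc k)} {m} →
               Unfolding κ₀ Γ Γ′ σ → Can κ Γ χ m → Can κ Γ′ (sub σ χ) m
  Can-unfold {σ = σ} u (base c)  = base (ConstIn-sub σ c)
  Can-unfold         u (later c) = later (Can-unfold u c)
  Can-unfold {κ = κ} {σ = σ} u (bound x o b c) with Binds-unfold u b
  ... | unfolded f = later (Can-mono (sub-≼ σ o) (f c))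
  ... | inside {Δ₀′ = Δ₀′} {β = β} y e u₀ b′ =
    bound y (_≼_.occurs (sub-≼ σ o) (subst (Occurs y) (sym e) (var y))) b′
      (subst (λ χ → Can κ Δ₀′ χ _) (sub-fix κ _ β) (Can-unfold u₀ c))

  Every-unfolding-var : ∀ {κ₀ k} {Γ : Ctx n (suc k)} {Γ′ σ} → Unfolding κ₀ Γ Γ′ σ → ∀ x →
                        Every (Can∃ κ₀) Γ′ (σ x) ⊎ ∃ λ y → σ x ≡ var y
  Every-unfolding-var (top e)   zero    = inj₁ e
  Every-unfolding-var (under u) zero    = inj₂ (zero , refl)
  Every-unfolding-var (under {σ = σ} u) (suc x) with Every-unfolding-var u x
  ... | inj₁ e       = inj₁ (Every-weaken insert (σ x) e)
  ... | inj₂ (y , e) = inj₂ (suc y , cong (rename suc) e)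

  Every-unfold : ∀ {κ₀ k} {Γ : Ctx n (suc k)} {Γ′ σ} → Unfolding κ₀ Γ Γ′ σ →
                 (χ : Form n (suc k)) → Every (Can∃ κ₀) Γ χ → Every (Can∃ κ₀) Γ′ (sub σ χ)
  Every-unfold u tt          (m , c)            = m , Can-unfold u c
  Every-unfold u ff          (m , c)            = m , Can-unfold u c
  Every-unfold {κ₀} {Γ′ = Γ′} u (var x) (m , c) with Every-unfolding-var u x
  ... | inj₁ e       = e
  ... | inj₂ (y , e) = subst (Every (Can∃ κ₀) Γ′) (sym e) (m , subst (λ χ → Can κ₀ Γ′ χ m) e (Can-unfold u c))
  Every-unfold u (φ ∨ ψ)     ((m , c) , e , e′) = (m , Can-unfold u c) , Every-unfold u φ e , Every-unfold u ψ e′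
  Every-unfold u (φ ∧ ψ)     ((m , c) , e , e′) = (m , Can-unfold u c) , Every-unfold u φ e , Every-unfold u ψ e′
  Every-unfold u (⟨ a ⟩ φ)   ((m , c) , e)      = (m , Can-unfold u c) , Every-unfold u φ e
  Every-unfold u ([ a ] φ)   ((m , c) , e)      = (m , Can-unfold u c) , Every-unfold u φ e
  Every-unfold u (min φ)     ((m , c) , e)      = (m , Can-unfold u c) , Every-unfold (under u) φ e
  Every-unfold u (max φ)     ((m , c) , e)      = (m , Can-unfold u c) , Every-unfold (under u) φ e
  Every-unfold u (bigOr φs)  ((m , c) , e)      = (m , Can-unfold u c) , λ b → Every-unfold u (φs b) (e b)
  Every-unfold u (bigAnd φs) ((m , c) , e)      = (m , Can-unfold u c) , λ b → Every-unfold u (φs b) (e b)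

  single-preserves : ∀ {k} (P : Form n k → Set) → (∀ i → P (var i)) → ∀ {χ} → P χ → ∀ x → P (single χ x)
  single-preserves P pvar pχ zero    = pχ
  single-preserves P pvar pχ (suc i) = pvar i

  size-unfold : ∀ κ (β : Form n 1) → ¬ Unguarded zero β → size (β [ fix κ β ]) ≡ size β
  size-unfold κ β g = size-sub (single (fix κ β)) β bound-var-guarded
    where bound-var-guarded : ∀ x → Unguarded x β → ∃ λ y → single (fix κ β) x ≡ var y
          bound-var-guarded zero u = ⊥-elim (g u)

  step-· : ∀ (a : Act n) f → step (a · f) ≡ just (a , f)
  step-· a (inj₁ l) = refl
  step-· a (inj₂ s) = refl

  tt-cannot-refute : ∀ {k} {Γ : Ctx n k} {m} → ¬ Can ν Γ tt m
  tt-cannot-refute (base ())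
  tt-cannot-refute (later c) = tt-cannot-refute c
  tt-cannot-refute (bound _ () _ _)

  ff-cannot-verify : ∀ {k} {Γ : Ctx n k} {m} → ¬ Can μ Γ ff m
  ff-cannot-verify (base ())
  ff-cannot-verify (later c) = ff-cannot-verify c
  ff-cannot-verify (bound _ () _ _)

  Derivativeˢ : Act n → Form n 0 → Set₁
  Derivativeˢ a φ = Σ (Form n 0) λ ψ → SE ψ × Guarded ψ × Every CanRefute ε ψ ×
                      (∀ (f : Trace n) → ⟦ φ ⟧₀ (a · f) → ⟦ ψ ⟧₀ f)

  Derivativeᶜ : Act n → Form n 0 → Set₁
  Derivativeᶜ a φ = Σ (Form n 0) λ ψ → CE ψ × Guarded ψ × Every CanVerify ε ψ ×
                      (∀ (f : Trace n) → ⟦ ψ ⟧₀ f → ⟦ φ ⟧₀ (a · f))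

  Derivativeˢ-∧ : ∀ {a} {φ ψ : Form n 0} → Derivativeˢ a φ → Derivativeˢ a ψ → Derivativeˢ a (φ ∧ ψ)
  Derivativeˢ-∧ (φ′ , s , g , e , d) (ψ′ , s′ , g′ , e′ , d′) =
    φ′ ∧ ψ′ , s ∧ s′ , g ∧ g′ , (refutes , e , e′) , λ f t → d f (proj₁ t) , d′ f (proj₂ t)
    where refutes : CanRefute ε (φ′ ∧ ψ′)
          refutes = let (m , c) = Every-here φ′ e in m , Can-mono (mk≼ ∧ˡ ∧ˡ) c

  Derivativeᶜ-∨ : ∀ {a} {φ ψ : Form n 0} → Derivativeᶜ a φ → Derivativeᶜ a ψ → Derivativeᶜ a (φ ∨ ψ)
  Derivativeᶜ-∨ {a} {φ} {ψ} (φ′ , s , g , e , d) (ψ′ , s′ , g′ , e′ , d′) =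
    φ′ ∨ ψ′ , s ∨ s′ , g ∨ g′ , (verifies , e , e′) , sound
    where verifies : CanVerify ε (φ′ ∨ ψ′)
          verifies = let (m , c) = Every-here φ′ e in m , Can-mono (mk≼ ∨ˡ ∨ˡ) c
          sound : ∀ f → ⟦ φ′ ∨ ψ′ ⟧₀ f → ⟦ φ ∨ ψ ⟧₀ (a · f)
          sound f (inj₁ t) = inj₁ (d f t)
          sound f (inj₂ t) = inj₂ (d′ f t)

  Derivativeˢ-max : ∀ {a} (β : Form n 1) → Derivativeˢ a (β [ max β ]) → Derivativeˢ a (max β)
  Derivativeˢ-max β (ψ , s , g , e , d) = ψ , s , g , e , λ f t → d f (unfold-max β t)

  Derivativeᶜ-min : ∀ {a} (β : Form n 1) → Derivativeᶜ a (β [ min β ]) → Derivativeᶜ a (min β)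
  Derivativeᶜ-min β (ψ , s , g , e , d) = ψ , s , g , e , λ f t → fold-min β (d f t)

  derivativeˢ : (a : Act n) (fuel : ℕ) (φ : Form n 0) → size φ ≤ fuel →
                SE φ → Guarded φ → Every CanRefute ε φ → Derivativeˢ a φ
  derivativeˢ a fuel tt _ _ _ (_ , c) = ⊥-elim (tt-cannot-refute c)
  derivativeˢ a fuel ff _ _ _ e       = ff , ff , ff , e , λ f t → t
  derivativeˢ a (suc fuel) (φ ∧ ψ) (s≤s p) (s ∧ s′) (g ∧ g′) (_ , e , e′) =
    Derivativeˢ-∧ (derivativeˢ a fuel φ (m+n≤o⇒m≤o (size φ) p) s g e)
                  (derivativeˢ a fuel ψ (m+n≤o⇒n≤o (size φ) p) s′ g′ e′)
  derivativeˢ a (suc fuel) (max β) (s≤s p) (max s) (max u g) e =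
    Derivativeˢ-max β (derivativeˢ a fuel (β [ max β ])
      (subst (_≤ fuel) (sym (size-unfold ν β u)) p)
      (SE-sub (single (max β)) (single-preserves SE var (max s)) s)
      (Guarded-sub (single (max β)) (single-preserves Guarded var (max u g)) g)
      (Every-unfold (top e) β (proj₂ e)))
  derivativeˢ a fuel (bigAnd φs) _ (bigAnd ss) (bigAnd gs) (_ , es) =
    φs a , ss a , gs a , es a , λ f H → H a f (step-· a f)

  derivativeᶜ : (a : Act n) (fuel : ℕ) (φ : Form n 0) → size φ ≤ fuel →
                CE φ → Guarded φ → Every CanVerify ε φ → Derivativeᶜ a φ
  derivativeᶜ a fuel ff _ _ _ (_ , c) = ⊥-elim (ff-cannot-verify c)
  derivativeᶜ a fuel tt _ _ _ e       = tt , tt , tt , e , λ f t → t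
  derivativeᶜ a (suc fuel) (φ ∨ ψ) (s≤s p) (s ∨ s′) (g ∨ g′) (_ , e , e′) =
    Derivativeᶜ-∨ (derivativeᶜ a fuel φ (m+n≤o⇒m≤o (size φ) p) s g e)
                  (derivativeᶜ a fuel ψ (m+n≤o⇒n≤o (size φ) p) s′ g′ e′)
  derivativeᶜ a (suc fuel) (min β) (s≤s p) (min s) (min u g) e =
    Derivativeᶜ-min β (derivativeᶜ a fuel (β [ min β ])
      (subst (_≤ fuel) (sym (size-unfold μ β u)) p)
      (CE-sub (single (min β)) (single-preserves CE var (min s)) s)
      (Guarded-sub (single (min β)) (single-preserves Guarded var (min u g)) g)
      (Every-unfold (top e) β (proj₂ e)))
  derivativeᶜ a fuel (bigOr φs) _ (bigOr ss) (bigOr gs) (_ , es) =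
    φs a , ss a , gs a , es a , λ f t → a , f , step-· a f , t

lemma14 : ∀ {n : ℕ} (a : Act n) →
    ((φ : Form n 0) → SE φ → Guarded φ → Every CanRefute ε φ →
      Σ (Form n 0) λ ψ → SE ψ × Guarded ψ × Every CanRefute ε ψ ×
        (∀ (f : Trace n) → ⟦ φ ⟧₀ (a · f) → ⟦ ψ ⟧₀ f))
    ×
    ((φ : Form n 0) → CE φ → Guarded φ → Every CanVerify ε φ →
      Σ (Form n 0) λ ψ → CE ψ × Guarded ψ × Every CanVerify ε ψ ×
        (∀ (f : Trace n) → ⟦ ψ ⟧₀ f → ⟦ φ ⟧₀ (a · f)))
lemma14 a = (λ φ → derivativeˢ a (size φ) φ ≤-refl) , (λ φ → derivativeᶜ a (size φ) φ ≤-refl)
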